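{- For every integer $n>2$, \[ \overline{\mathrm{spt}}1_o'(n)+\overline{\mathrm{spt}}1_o'(n-2)=-\overline{p}_{oex}'(n-1). \]
   Context: An overpartition of $n$ is a partition of $n$ in which the first occurrence of each distinct part size may be overlined. For an overpartition $\pi$, $s(\pi)$ denotes its smallest non-overlined part. Let $\overline{\mathrm{Spt}}1_o(n)$ be the set of overpartitions $\pi$ of $n$ having at least one non-overlined part, such that $s(\pi)$ appears exactly once, every overlined part is strictly bigger than $s(\pi)$, and every part other than $s(\pi)$ has parity different from that of $s(\pi)$. Let $\overline{\mathrm{spt}}1_o'(n)$ be the number of $\pi\in\overline{\mathrm{Spt}}1_o(n)$ with an even number of parts (counted with multiplicity) greater than $s(\pi)$, minus the number of those with an odd number of such parts. Let $\overline{p}_{oex}'(m)$ be the number of overpartitions of $m$ into odd parts with no non-overlined part equal to $1$ having an even number of parts, minus the number of such overpartitions having an odd number of parts (parts counted with multiplicity); equivalently $\sum_{m\ge0}\overline{p}_{oex}'(m)q^m=\frac{(q;q^2)_\infty}{(-q^3;q^2)_\infty}$, where $(a;q^2)_\infty=\prod_{j\ge0}(1-aq^{2j})$. -}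

module Defs where

open import Data.Nat as ℕ using (ℕ; zero; suc; _+_; _*_; _%_; _≡ᵇ_; _<ᵇ_)
open import Data.Bool using (Bool; true; false; _∧_; _∨_; not; if_then_else_)
open import Data.Product using (_×_; _,_)
open import Data.List using (List; []; _∷_; map; concatMap; upTo; foldr)
open import Data.Vec using (Vec; []; _∷_)
open import Data.Maybe using (Maybe; just; nothing)
open import Data.Integer as ℤ using (ℤ)

-- An overpartition whose parts are all ≤ k is encoded canonically by a
-- vector of length k whose i-th entry (i = 0,1,…,k-1) is a pair (m , b):
--   m = number of NON-overlined parts equal to i+1,
--   b = whether the part i+1 also occurs overlined (at most once, since
--       only the first occurrence of a part size may be overlined).
-- Any overpartition of n has all parts ≤ n and every multiplicity ≤ n,
-- so the overpartitions of n are exactly the vectors in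
-- 'candidates n n' of weight n.

MultVec : ℕ → Set
MultVec k = Vec (ℕ × Bool) k

candidates : (bound k : ℕ) → List (MultVec k)
candidates bound zero    = [] ∷ []
candidates bound (suc k) =
  concatMap (λ v → concatMap (λ m → map (λ b → (m , b) ∷ v) (true ∷ false ∷ []))
                             (upTo (suc bound)))
            (candidates bound k)

-- entries as (part size, non-overlined multiplicity, overlined?) in
-- increasing order of part size
Entry : Set
Entry = ℕ × ℕ × Bool

entriesFrom : ∀ {k} → ℕ → MultVec k → List Entry
entriesFrom s []             = []
entriesFrom s ((m , b) ∷ v)  = (s , m , b) ∷ entriesFrom (suc s) v

entries : ∀ {k} → MultVec k → List Entry
entries = entriesFrom 1

allB : (Entry → Bool) → List Entry → Bool
allB p = foldr (λ e acc → p e ∧ acc) true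

b2n : Bool → ℕ
b2n true  = 1
b2n false = 0

weight : List Entry → ℕ
weight = foldr (λ { (k , m , b) acc → k * (m + b2n b) + acc }) 0

numParts : List Entry → ℕ
numParts = foldr (λ { (k , m , b) acc → m + b2n b + acc }) 0

isEven : ℕ → Bool
isEven k = k % 2 ≡ᵇ 0

smallestNonOver : List Entry → Maybe ℕ
smallestNonOver []              = nothing
smallestNonOver ((k , zero , b) ∷ es)  = smallestNonOver es
smallestNonOver ((k , suc m , b) ∷ es) = just k

partsAbove : ℕ → List Entry → ℕ
partsAbove s = foldr (λ { (k , m , b) acc → (if s <ᵇ k then m + b2n b else 0) + acc }) 0

-- local condition at part size k, given s = s(π):
--  * every overlined part is strictly bigger than s;
--  * s appears exactly once (as non-overlined; an overlined s is excluded
--    by the previous clause);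
--  * every part other than s has parity different from s
--    (parts below s do not exist: none non-overlined by minimality of s,
--     none overlined by the first clause).
sptOK : ℕ → Entry → Bool
sptOK s (k , m , b) =
  (if b then s <ᵇ k else true)
  ∧ (if k ≡ᵇ s then m ≡ᵇ 1 else true)
  ∧ (if (s <ᵇ k) ∧ ((0 <ᵇ m) ∨ b) then not (isEven k ≡ᵇ' isEven s) else true)
  where
    _≡ᵇ'_ : Bool → Bool → Bool
    true  ≡ᵇ' y = y
    false ≡ᵇ' y = not y

sign : ℕ → ℤ
sign zero    = ℤ.+ 1
sign (suc j) = ℤ.- sign j

-- signed contribution of an overpartition (given by its entries) to
-- spt1_o'-bar : 0 if not in Spt1_o-bar, else (-1)^(#parts > s(π))
sptContribution : List Entry → ℤ
sptContribution es with smallestNonOver es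
... | nothing = ℤ.+ 0
... | just s  = if allB (sptOK s) es then sign (partsAbove s es) else ℤ.+ 0

sumℤ : List ℤ → ℤ
sumℤ = foldr ℤ._+_ (ℤ.+ 0)

spt1o' : ℕ → ℤ
spt1o' n = sumℤ (map (λ v → let es = entries v in
                         if weight es ≡ᵇ n then sptContribution es else ℤ.+ 0)
                     (candidates n n))

oexOK : Entry → Bool
oexOK (k , m , b) =
  (if isEven k then (m ≡ᵇ 0) ∧ not b else true)
  ∧ (if k ≡ᵇ 1 then m ≡ᵇ 0 else true)

poex' : ℕ → ℤ
poex' n = sumℤ (map (λ v → let es = entries v in
                          if (weight es ≡ᵇ n) ∧ allB oexOK es
                          then sign (numParts es) else ℤ.+ 0)
                    (candidates n n))

{-# OPTIONS --safe #-}
-- Let P_t = ∏_{j > t, j ≢ t (mod 2)} (1 - q^j)/(1 + q^j). Grouping the overpartitions of Spt1_o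
-- by s(π) = t, the part t contributes q^t and every larger part size j of the other parity
-- contributes (1 - q^j) ∑_m (-q^j)^m = (1 - q^j)/(1 + q^j), so ∑ spt1o'(n) qⁿ = ∑_{t ≥ 1} q^t P_t,
-- while ∑ poex'(n) qⁿ = (1 - q) P_2. The relation (1 + q^(t+1)) P_t = (1 - q^(t+1)) P_(t+2) makes
-- (1 + q²) ∑_{t ≥ 1} q^t P_t telescope to 2q - q (1 + q) P_0 = 2q - q (1 - q) P_2.
-- All series are handled coefficientwise, as computed by the enumerations defining spt1o' and
-- poex'; their truncations (of multiplicities and of part sizes) do not affect the coefficients
-- involved.
module Submission where

open import Defs
open import Data.Nat using (ℕ; _<_; _∸_)
open import Data.Integer using (ℤ; _+_; -_)
open import Relation.Binary.PropositionalEquality using (_≡_)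

open import Data.Bool using (Bool; true; false; not; _∧_; _∨_; _xor_; if_then_else_)
open import Data.Bool.Properties using (T-≡; xor-same)
open import Data.Empty using (⊥-elim)
open import Data.Integer using (0ℤ; 1ℤ; _*_; _-_)
import Data.Integer.Properties as ℤ
open import Data.Integer.Tactic.RingSolver using (solve-∀)
open import Data.List using (List; []; _∷_; _++_; map; concatMap; foldr; upTo)
import Data.List.Properties as List
open import Data.Maybe using (just; nothing)
open import Data.Nat using (zero; suc; _≤_; _<ᵇ_; _≡ᵇ_; z≤n; s≤s; NonZero)
  renaming (_+_ to _+ℕ_; _*_ to _*ℕ_)
import Data.Nat.Properties as ℕ
open import Data.Product using (_,_)
open import Data.Vec using ([]; _∷_)
open import Function using (_∘_)
open import Function.Bundles using (Equivalence)
open import Relation.Binary.PropositionalEquality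
  using (_≢_; refl; sym; trans; cong; cong₂; subst; module ≡-Reasoning)

open ≡-Reasoning

private variable
  A A′ : Set

-- Finite sums

∑ : (A → ℤ) → List A → ℤ
∑ f xs = sumℤ (map f xs)

∑-cong : {f g : A → ℤ} → (∀ x → f x ≡ g x) → ∀ xs → ∑ f xs ≡ ∑ g xs
∑-cong f≗g xs = cong sumℤ (List.map-cong f≗g xs)

∑-zero : {f : A → ℤ} → (∀ x → f x ≡ 0ℤ) → ∀ xs → ∑ f xs ≡ 0ℤ
∑-zero f≗0 []       = refl
∑-zero f≗0 (x ∷ xs) = cong₂ _+_ (f≗0 x) (∑-zero f≗0 xs)

∑-+ : ∀ (f g : A → ℤ) xs → ∑ (λ x → f x + g x) xs ≡ ∑ f xs + ∑ g xs
∑-+ f g []       = refl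
∑-+ f g (x ∷ xs) =
  trans (cong (f x + g x +_) (∑-+ f g xs)) (+-interchange (f x) (g x) (∑ f xs) (∑ g xs))
  where
  +-interchange : ∀ a b c d → (a + b) + (c + d) ≡ (a + c) + (b + d)
  +-interchange = solve-∀

∑-*ˡ : ∀ c (f : A → ℤ) xs → ∑ (λ x → c * f x) xs ≡ c * ∑ f xs
∑-*ˡ c f []       = sym (ℤ.*-zeroʳ c)
∑-*ˡ c f (x ∷ xs) =
  trans (cong (c * f x +_) (∑-*ˡ c f xs)) (sym (ℤ.*-distribˡ-+ c (f x) (∑ f xs)))

∑-++ : ∀ (f : A → ℤ) xs ys → ∑ f (xs ++ ys) ≡ ∑ f xs + ∑ f ys
∑-++ f []       ys = sym (ℤ.+-identityˡ (∑ f ys))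
∑-++ f (x ∷ xs) ys =
  trans (cong (f x +_) (∑-++ f xs ys)) (sym (ℤ.+-assoc (f x) (∑ f xs) (∑ f ys)))

∑-map : ∀ (f : A′ → ℤ) (g : A → A′) xs → ∑ f (map g xs) ≡ ∑ (f ∘ g) xs
∑-map f g xs = cong sumℤ (sym (List.map-∘ xs))

∑-concatMap : ∀ (g : A′ → ℤ) (f : A → List A′) xs →
              ∑ g (concatMap f xs) ≡ ∑ (λ x → ∑ g (f x)) xs
∑-concatMap g f []       = refl
∑-concatMap g f (x ∷ xs) =
  trans (∑-++ g (f x) (concatMap f xs)) (cong (∑ g (f x) +_) (∑-concatMap g f xs))

∑-comm : ∀ (g : A → A′ → ℤ) xs ys →
         ∑ (λ x → ∑ (g x) ys) xs ≡ ∑ (λ y → ∑ (λ x → g x y) xs) ys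
∑-comm g []       ys = sym (∑-zero (λ _ → refl) ys)
∑-comm g (x ∷ xs) ys =
  trans (cong (∑ (g x) ys +_) (∑-comm g xs ys))
        (sym (∑-+ (g x) (λ y → ∑ (λ x → g x y) xs) ys))

∑-upTo-suc : ∀ (f : ℕ → ℤ) n → ∑ f (upTo (suc n)) ≡ f 0 + ∑ (f ∘ suc) (upTo n)
∑-upTo-suc f n =
  cong (f 0 +_) (cong sumℤ (trans (List.map-applyUpTo suc f n)
                                  (sym (List.map-upTo (f ∘ suc) n))))

∑-upTo-truncate : ∀ (f : ℕ → ℤ) {n B} → n ≤ B → (∀ m → n < m → f m ≡ 0ℤ) →
                  ∑ f (upTo (suc B)) ≡ ∑ f (upTo (suc n))
∑-upTo-truncate f {zero} {B} _ f≡0 =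
  trans (∑-upTo-suc f B)
        (cong (f 0 +_) (∑-zero (λ m → f≡0 (suc m) (s≤s z≤n)) (upTo B)))
∑-upTo-truncate f {suc n} {suc B} (s≤s n≤B) f≡0 = begin
  ∑ f (upTo (2 +ℕ B))                  ≡⟨ ∑-upTo-suc f (suc B) ⟩
  f 0 + ∑ (f ∘ suc) (upTo (suc B))     ≡⟨ cong (f 0 +_) (∑-upTo-truncate (f ∘ suc) n≤B
                                              (λ m n<m → f≡0 (suc m) (s≤s n<m))) ⟩
  f 0 + ∑ (f ∘ suc) (upTo (suc n))     ≡⟨ ∑-upTo-suc f (suc n) ⟨
  ∑ f (upTo (2 +ℕ n))                  ∎

∑-telescope : ∀ (f : ℕ → ℤ) n → ∑ (λ m → f m - f (suc m)) (upTo n) ≡ f 0 - f n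
∑-telescope f zero    = sym (ℤ.+-inverseʳ (f 0))
∑-telescope f (suc n) = begin
  ∑ (λ m → f m - f (suc m)) (upTo (suc n))
    ≡⟨ ∑-upTo-suc (λ m → f m - f (suc m)) n ⟩
  (f 0 - f 1) + ∑ (λ m → f (suc m) - f (2 +ℕ m)) (upTo n)
    ≡⟨ cong ((f 0 - f 1) +_) (∑-telescope (f ∘ suc) n) ⟩
  (f 0 - f 1) + (f 1 - f (suc n))
    ≡⟨ ℤ.+-minus-telescope (f 0) (f 1) (f (suc n)) ⟩
  f 0 - f (suc n) ∎

-- Power series and the enumeration of overpartitions

Series : Set
Series = ℕ → ℤ

-- shift d X = q^d X
shift : ℕ → Series → Series
shift zero    X n       = X n
shift (suc d) X zero    = 0ℤ
shift (suc d) X (suc n) = shift d X n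

δ : Series
δ zero    = 1ℤ
δ (suc n) = 0ℤ

shift-beyond : ∀ d (X : Series) {n} → n < d → shift d X n ≡ 0ℤ
shift-beyond (suc d) X {zero}  _         = refl
shift-beyond (suc d) X {suc n} (s≤s n<d) = shift-beyond d X n<d

shift-cong : ∀ d {X Y : Series} n → (∀ j → j ≤ n → X j ≡ Y j) →
             shift d X n ≡ shift d Y n
shift-cong zero    n       X≡Y = X≡Y n ℕ.≤-refl
shift-cong (suc d) zero    X≡Y = refl
shift-cong (suc d) (suc n) X≡Y = shift-cong d n (λ j j≤n → X≡Y j (ℕ.m≤n⇒m≤1+n j≤n))

shift-zero : ∀ d {X : Series} n → (∀ j → X j ≡ 0ℤ) → shift d X n ≡ 0ℤ
shift-zero zero    n       X≡0 = X≡0 n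
shift-zero (suc d) zero    X≡0 = refl
shift-zero (suc d) (suc n) X≡0 = shift-zero d n X≡0

shift-*ˡ : ∀ d c (X : Series) n → shift d (λ j → c * X j) n ≡ c * shift d X n
shift-*ˡ zero    c X n       = refl
shift-*ˡ (suc d) c X zero    = sym (ℤ.*-zeroʳ c)
shift-*ˡ (suc d) c X (suc n) = shift-*ˡ d c X n

shift-+ : ∀ d (X Y : Series) n → shift d (λ j → X j + Y j) n ≡ shift d X n + shift d Y n
shift-+ zero    X Y n       = refl
shift-+ (suc d) X Y zero    = refl
shift-+ (suc d) X Y (suc n) = shift-+ d X Y n

shift-shift : ∀ a b (X : Series) n → shift a (shift b X) n ≡ shift (a +ℕ b) X n
shift-shift zero    b X n       = refl
shift-shift (suc a) b X zero    = refl
shift-shift (suc a) b X (suc n) = shift-shift a b X n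

∑-shift : ∀ d (X : A → Series) xs n →
          ∑ (λ x → shift d (X x) n) xs ≡ shift d (λ j → ∑ (λ x → X x j) xs) n
∑-shift zero    X xs n       = refl
∑-shift (suc d) X xs zero    = ∑-zero (λ _ → refl) xs
∑-shift (suc d) X xs (suc n) = ∑-shift d X xs n

bools : List Bool
bools = true ∷ false ∷ []

∑mb : ℕ → (ℕ → Bool → ℤ) → ℤ
∑mb B c = ∑ (λ m → ∑ (c m) bools) (upTo (suc B))

∑mb-cong : ∀ B {c c′ : ℕ → Bool → ℤ} → (∀ m b → c m b ≡ c′ m b) →
           ∑mb B c ≡ ∑mb B c′
∑mb-cong B c≡c′ = ∑-cong (λ m → ∑-cong (c≡c′ m) bools) (upTo (suc B))

∑mb-truncate : ∀ (c : ℕ → Bool → ℤ) {n B} → n ≤ B → (∀ m b → n < m → c m b ≡ 0ℤ) →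
               ∑mb B c ≡ ∑mb n c
∑mb-truncate c n≤B c≡0 =
  ∑-upTo-truncate _ n≤B (λ m n<m → ∑-zero (λ b → c≡0 m b n<m) bools)

∑mb-only-m≡0 : ∀ B (c : ℕ → Bool → ℤ) → (∀ m b → c (suc m) b ≡ 0ℤ) →
               ∑mb B c ≡ c 0 true + c 0 false
∑mb-only-m≡0 B c c≡0 =
  trans (∑mb-truncate c {0} {B} z≤n (λ { (suc m) b _ → c≡0 m b }))
        (drop-zeros (c 0 true) (c 0 false))
  where
  drop-zeros : ∀ x y → (x + (y + 0ℤ)) + 0ℤ ≡ x + y
  drop-zeros = solve-∀

∑-candidates-suc : ∀ B k (F : MultVec (suc k) → ℤ) →
                   ∑ F (candidates B (suc k)) ≡
                   ∑mb B (λ m b → ∑ (λ v → F ((m , b) ∷ v)) (candidates B k))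
∑-candidates-suc B k F = begin
  ∑ F (candidates B (suc k))
    ≡⟨ ∑-concatMap F (λ v → concatMap (extend v) ms) vs ⟩
  ∑ (λ v → ∑ F (concatMap (extend v) ms)) vs
    ≡⟨ ∑-cong (λ v → trans (∑-concatMap F (extend v) ms)
                           (∑-cong (λ m → ∑-map F (λ b → (m , b) ∷ v) bools) ms)) vs ⟩
  ∑ (λ v → ∑ (λ m → ∑ (λ b → F ((m , b) ∷ v)) bools) ms) vs
    ≡⟨ ∑-comm (λ v m → ∑ (λ b → F ((m , b) ∷ v)) bools) vs ms ⟩
  ∑ (λ m → ∑ (λ v → ∑ (λ b → F ((m , b) ∷ v)) bools) vs) ms
    ≡⟨ ∑-cong (λ m → ∑-comm (λ v b → F ((m , b) ∷ v)) vs bools) ms ⟩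
  ∑mb B (λ m b → ∑ (λ v → F ((m , b) ∷ v)) vs) ∎
  where
  vs = candidates B k
  ms = upTo (suc B)
  extend : MultVec k → ℕ → List (MultVec (suc k))
  extend v m = map (λ b → (m , b) ∷ v) bools

coeff : ℕ → (List Entry → ℤ) → List Entry → ℤ
coeff n G es = if weight es ≡ᵇ n then G es else 0ℤ

-- GF B s k G = ∑ G(π) q^|π| over the overpartitions π with parts in [s, s + k)
-- and at most B non-overlined copies of each part
GF : (B s k : ℕ) → (List Entry → ℤ) → Series
GF B s k G n = ∑ (λ v → coeff n G (entriesFrom s v)) (candidates B k)

if-+-≡ᵇ : ∀ a w n (x : ℤ) →
          (if a +ℕ w ≡ᵇ n then x else 0ℤ) ≡ shift a (λ j → if w ≡ᵇ j then x else 0ℤ) n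
if-+-≡ᵇ zero    w n       x = refl
if-+-≡ᵇ (suc a) w zero    x = refl
if-+-≡ᵇ (suc a) w (suc n) x = if-+-≡ᵇ a w n x

if-*ˡ : ∀ b c x → (if b then c * x else 0ℤ) ≡ c * (if b then x else 0ℤ)
if-*ˡ true  c x = refl
if-*ˡ false c x = sym (ℤ.*-zeroʳ c)

GF-suc : ∀ B s k G n →
         GF B s (suc k) G n ≡
         ∑mb B (λ m b → shift (s *ℕ (m +ℕ b2n b)) (GF B (suc s) k (G ∘ ((s , m , b) ∷_))) n)
GF-suc B s k G n =
  trans (∑-candidates-suc B k _) (∑mb-cong B λ m b →
    trans (∑-cong (λ v → if-+-≡ᵇ (s *ℕ (m +ℕ b2n b)) (weight (entriesFrom (suc s) v)) n
                                 (G ((s , m , b) ∷ entriesFrom (suc s) v)))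
                  (candidates B k))
          (∑-shift (s *ℕ (m +ℕ b2n b))
                   (λ v j → coeff j (G ∘ ((s , m , b) ∷_)) (entriesFrom (suc s) v))
                   (candidates B k) n))

GF-cong : ∀ B s k G G′ n →
          (∀ (v : MultVec k) → G (entriesFrom s v) ≡ G′ (entriesFrom s v)) →
          GF B s k G n ≡ GF B s k G′ n
GF-cong B s k G G′ n G≡G′ =
  ∑-cong (λ v → cong (λ x → if weight (entriesFrom s v) ≡ᵇ n then x else 0ℤ) (G≡G′ v))
         (candidates B k)

GF-zero : ∀ B s k G n → (∀ (v : MultVec k) → G (entriesFrom s v) ≡ 0ℤ) →
          GF B s k G n ≡ 0ℤ
GF-zero B s k G n G≡0 =
  ∑-zero (λ v → if-0 (weight (entriesFrom s v) ≡ᵇ n) (G≡0 v)) (candidates B k)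
  where
  if-0 : ∀ c {x} → x ≡ 0ℤ → (if c then x else 0ℤ) ≡ 0ℤ
  if-0 true  x≡0 = x≡0
  if-0 false _   = refl

GF-*ˡ : ∀ B s k c G n → GF B s k (λ es → c * G es) n ≡ c * GF B s k G n
GF-*ˡ B s k c G n =
  trans (∑-cong (λ v → if-*ˡ (weight (entriesFrom s v) ≡ᵇ n) c (G (entriesFrom s v)))
                (candidates B k))
        (∑-*ˡ c _ (candidates B k))

GF-bound : ∀ k s G {B B′} n → n ≤ B → n ≤ B′ →
           GF B (suc s) k G n ≡ GF B′ (suc s) k G n
GF-bound zero    s G n _ _ = refl
GF-bound (suc k) s G {B} {B′} n n≤B n≤B′ = begin
  GF B (suc s) (suc k) G n   ≡⟨ GF-suc B (suc s) k G n ⟩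
  ∑mb B (term B)             ≡⟨ ∑mb-truncate (term B) n≤B (beyond B) ⟩
  ∑mb n (term B)             ≡⟨ ∑mb-cong n (λ m b → shift-cong (suc s *ℕ (m +ℕ b2n b)) n λ j j≤n →
                                  GF-bound k (suc s) (G ∘ ((suc s , m , b) ∷_)) j
                                           (ℕ.≤-trans j≤n n≤B) (ℕ.≤-trans j≤n n≤B′)) ⟩
  ∑mb n (term B′)            ≡⟨ ∑mb-truncate (term B′) n≤B′ (beyond B′) ⟨
  ∑mb B′ (term B′)           ≡⟨ GF-suc B′ (suc s) k G n ⟨
  GF B′ (suc s) (suc k) G n  ∎
  where
  term : ℕ → ℕ → Bool → ℤ
  term B m b = shift (suc s *ℕ (m +ℕ b2n b)) (GF B (2 +ℕ s) k (G ∘ ((suc s , m , b) ∷_))) n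

  beyond : ∀ B m b → n < m → term B m b ≡ 0ℤ
  beyond B m b n<m = shift-beyond _ _
    (ℕ.<-≤-trans n<m (ℕ.≤-trans (ℕ.m≤m+n m (b2n b)) (ℕ.m≤n*m (m +ℕ b2n b) (suc s))))

-- coefficients of (∑_{m ≤ B, b} g m b q^(s (m + b))) X
mulFactor : (B s : ℕ) → (ℕ → Bool → ℤ) → Series → Series
mulFactor B s g X n = ∑mb B (λ m b → g m b * shift (s *ℕ (m +ℕ b2n b)) X n)

mulFactor-cong : ∀ B s {g g′ X Y} n →
                 (∀ m b → g m b ≡ g′ m b) → (∀ j → j ≤ n → X j ≡ Y j) →
                 mulFactor B s g X n ≡ mulFactor B s g′ Y n
mulFactor-cong B s n g≡g′ X≡Y =
  ∑mb-cong B λ m b → cong₂ _*_ (g≡g′ m b) (shift-cong (s *ℕ (m +ℕ b2n b)) n X≡Y)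

mulFactor-binomial : ∀ B s g X n → (∀ m b → g (suc m) b ≡ 0ℤ) →
                     mulFactor B s g X n ≡ g 0 true * shift s X n + g 0 false * X n
mulFactor-binomial B s g X n g≡0 =
  trans (∑mb-only-m≡0 B (λ m b → g m b * shift (s *ℕ (m +ℕ b2n b)) X n)
                      (λ m b → trans (cong (_* shift (s *ℕ (suc m +ℕ b2n b)) X n) (g≡0 m b))
                                     (ℤ.*-zeroˡ (shift (s *ℕ (suc m +ℕ b2n b)) X n))))
        (cong₂ (λ d d′ → g 0 true * shift d X n + g 0 false * shift d′ X n)
               (ℕ.*-identityʳ s) (ℕ.*-zeroʳ s))

mulFactor-below : ∀ B s g X {n} → n < s → mulFactor B s g X n ≡ g 0 false * X n
mulFactor-below B s g X {n} n<s = begin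
  mulFactor B s g X n
    ≡⟨ ∑mb-only-m≡0 B (λ m b → g m b * shift (s *ℕ (m +ℕ b2n b)) X n)
                      (λ m b → vanish (suc m) b) ⟩
  g 0 true * shift (s *ℕ 1) X n + g 0 false * shift (s *ℕ 0) X n
    ≡⟨ cong₂ _+_ (vanish 0 true) (cong (λ d → g 0 false * shift d X n) (ℕ.*-zeroʳ s)) ⟩
  0ℤ + g 0 false * X n
    ≡⟨ ℤ.+-identityˡ _ ⟩
  g 0 false * X n ∎
  where
  vanish : ∀ m b → {{_ : NonZero (m +ℕ b2n b)}} →
           g m b * shift (s *ℕ (m +ℕ b2n b)) X n ≡ 0ℤ
  vanish m b =
    trans (cong (g m b *_) (shift-beyond _ X (ℕ.<-≤-trans n<s (ℕ.m≤m*n s (m +ℕ b2n b)))))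
          (ℤ.*-zeroʳ (g m b))

-- the factor of part size j in P_t: (1 - q^j)/(1 + q^j) = ∑_{m, b} (-1)^(m+b) q^(j (m+b)) if o,
-- that is, if j and t have opposite parity, and 1 otherwise
partWeight : Bool → ℕ → Bool → ℤ
partWeight o m b = if (if (0 <ᵇ m) ∨ b then o else true) then sign (m +ℕ b2n b) else 0ℤ

partWeight-opposite : ∀ m b → partWeight true m b ≡ sign (m +ℕ b2n b)
partWeight-opposite m b with (0 <ᵇ m) ∨ b
... | true  = refl
... | false = refl

mulFactor-unit : ∀ B s X n → mulFactor B s (partWeight false) X n ≡ X n
mulFactor-unit B s X n =
  trans (mulFactor-binomial B s (partWeight false) X n (λ m b → refl))
        (trans (cong₂ _+_ (ℤ.*-zeroˡ (shift s X n)) (ℤ.*-identityˡ (X n)))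
               (ℤ.+-identityˡ (X n)))

module _ (B s : ℕ) (X : Series) where

  private
    τ : ℕ → Series
    τ m j = sign m * shift (suc s *ℕ m) X j

    mulFactor-sign-expand : ∀ j → mulFactor B (suc s) (partWeight true) X j ≡
                                  ∑ (λ m → τ (suc m) j + τ m j) (upTo (suc B))
    mulFactor-sign-expand j =
      ∑-cong (λ m → cong₂ _+_ (term m true (ℕ.+-comm m 1))
                              (trans (cong (_+ 0ℤ) (term m false (ℕ.+-identityʳ m)))
                                     (ℤ.+-identityʳ _)))
             (upTo (suc B))
      where
      term : ∀ m b {e} → m +ℕ b2n b ≡ e →
             partWeight true m b * shift (suc s *ℕ (m +ℕ b2n b)) X j ≡ τ e j
      term m b refl = cong (_* shift (suc s *ℕ (m +ℕ b2n b)) X j) (partWeight-opposite m b)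

    shift-τ : ∀ m n → shift (suc s) (τ m) n ≡ - τ (suc m) n
    shift-τ m n = begin
      shift (suc s) (τ m) n
        ≡⟨ shift-*ˡ (suc s) (sign m) _ n ⟩
      sign m * shift (suc s) (shift (suc s *ℕ m) X) n
        ≡⟨ cong (sign m *_) (shift-shift (suc s) (suc s *ℕ m) X n) ⟩
      sign m * shift (suc s +ℕ suc s *ℕ m) X n
        ≡⟨ cong (λ d → sign m * shift d X n) (ℕ.*-suc (suc s) m) ⟨
      sign m * shift (suc s *ℕ suc m) X n
        ≡⟨ flip-sign (sign m) _ ⟩
      - τ (suc m) n ∎
      where
      flip-sign : ∀ σ a → σ * a ≡ - ((- σ) * a)
      flip-sign = solve-∀

  mulFactor-sign : ∀ {n} → n ≤ B →
                   mulFactor B (suc s) (partWeight true) X n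
                   + shift (suc s) (mulFactor B (suc s) (partWeight true) X) n
                   ≡ X n - shift (suc s) X n
  mulFactor-sign {n} n≤B = begin
    mulFactor B (suc s) (partWeight true) X n
    + shift (suc s) (mulFactor B (suc s) (partWeight true) X) n
      ≡⟨ cong₂ _+_ (mulFactor-sign-expand n)
                   (trans (shift-cong (suc s) n (λ j _ → mulFactor-sign-expand j))
                          (sym (∑-shift (suc s) σ ms n))) ⟩
    ∑ (λ m → τ (suc m) n + τ m n) ms + ∑ (λ m → shift (suc s) (σ m) n) ms
      ≡⟨ ∑-+ (λ m → σ m n) (λ m → shift (suc s) (σ m) n) ms ⟨
    ∑ (λ m → σ m n + shift (suc s) (σ m) n) ms
      ≡⟨ ∑-cong pair-difference ms ⟩
    ∑ (λ m → f m - f (suc m)) ms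
      ≡⟨ ∑-telescope f (suc B) ⟩
    (τ 0 n + τ 1 n) - (τ (suc B) n + τ (2 +ℕ B) n)
      ≡⟨ cong₂ _-_ (cong₂ _+_ τ₀ τ₁)
                   (cong₂ _+_ (τ-beyond (suc B) ℕ.≤-refl) (τ-beyond (2 +ℕ B) (ℕ.n≤1+n _))) ⟩
    (X n - shift (suc s) X n) - 0ℤ
      ≡⟨ ℤ.+-identityʳ _ ⟩
    X n - shift (suc s) X n ∎
    where
    ms = upTo (suc B)

    σ : ℕ → Series
    σ m j = τ (suc m) j + τ m j

    f : ℕ → ℤ
    f m = τ m n + τ (suc m) n

    pair-difference : ∀ m → σ m n + shift (suc s) (σ m) n ≡ f m - f (suc m)
    pair-difference m = begin
      σ m n + shift (suc s) (σ m) n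
        ≡⟨ cong (σ m n +_) (shift-+ (suc s) (τ (suc m)) (τ m) n) ⟩
      σ m n + (shift (suc s) (τ (suc m)) n + shift (suc s) (τ m) n)
        ≡⟨ cong (σ m n +_) (cong₂ _+_ (shift-τ (suc m) n) (shift-τ m n)) ⟩
      (τ (suc m) n + τ m n) + (- τ (2 +ℕ m) n + - τ (suc m) n)
        ≡⟨ regroup (τ m n) (τ (suc m) n) (τ (2 +ℕ m) n) ⟩
      f m - f (suc m) ∎
      where
      regroup : ∀ a b c → (b + a) + (- c + - b) ≡ (a + b) - (b + c)
      regroup = solve-∀

    τ₀ : τ 0 n ≡ X n
    τ₀ = trans (ℤ.*-identityˡ _) (cong (λ d → shift d X n) (ℕ.*-zeroʳ (suc s)))

    τ₁ : τ 1 n ≡ - shift (suc s) X n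
    τ₁ = trans (ℤ.-1*i≡-i _) (cong (λ d → - shift d X n) (ℕ.*-identityʳ (suc s)))

    τ-beyond : ∀ m → B < m → τ m n ≡ 0ℤ
    τ-beyond m B<m =
      trans (cong (sign m *_)
                  (shift-beyond _ X (ℕ.≤-<-trans n≤B (ℕ.<-≤-trans B<m (ℕ.m≤n*m m (suc s))))))
            (ℤ.*-zeroʳ (sign m))

∏ : (Entry → ℤ) → List Entry → ℤ
∏ h = foldr (λ e acc → h e * acc) 1ℤ

sign-+ : ∀ a c → sign (a +ℕ c) ≡ sign a * sign c
sign-+ zero    c = sym (ℤ.*-identityˡ (sign c))
sign-+ (suc a) c = trans (cong -_ (sign-+ a c)) (ℤ.neg-distribˡ-* (sign a) (sign c))

allB-sign≡∏ : ∀ (p : Entry → Bool) (c : Entry → ℕ) es →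
              (if allB p es then sign (foldr (λ e acc → c e +ℕ acc) 0 es) else 0ℤ) ≡
              ∏ (λ e → if p e then sign (c e) else 0ℤ) es
allB-sign≡∏ p c []       = refl
allB-sign≡∏ p c (e ∷ es) with p e
... | false = refl
... | true  = begin
  (if allB p es then sign (c e +ℕ Σc) else 0ℤ)
    ≡⟨ cong (λ x → if allB p es then x else 0ℤ) (sign-+ (c e) Σc) ⟩
  (if allB p es then sign (c e) * sign Σc else 0ℤ)
    ≡⟨ if-*ˡ (allB p es) (sign (c e)) (sign Σc) ⟩
  sign (c e) * (if allB p es then sign Σc else 0ℤ)
    ≡⟨ cong (sign (c e) *_) (allB-sign≡∏ p c es) ⟩
  sign (c e) * ∏ (λ e → if p e then sign (c e) else 0ℤ) es ∎
  where
  Σc = foldr (λ e acc → c e +ℕ acc) 0 es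

<ᵇ-true : ∀ {m n} → m < n → (m <ᵇ n) ≡ true
<ᵇ-true m<n = Equivalence.to T-≡ (ℕ.<⇒<ᵇ m<n)

<ᵇ-false : ∀ {m n} → n ≤ m → (m <ᵇ n) ≡ false
<ᵇ-false {m}     {zero}  _         = refl
<ᵇ-false {suc m} {suc n} (s≤s n≤m) = <ᵇ-false n≤m

≡ᵇ-refl : ∀ n → (n ≡ᵇ n) ≡ true
≡ᵇ-refl n = Equivalence.to T-≡ (ℕ.≡⇒≡ᵇ n n refl)

≢⇒≡ᵇ-false : ∀ {m n} → m ≢ n → (m ≡ᵇ n) ≡ false
≢⇒≡ᵇ-false {m} {n} m≢n with m ≡ᵇ n | ℕ.≡ᵇ⇒≡ m n
... | true  | m≡n = ⊥-elim (m≢n (m≡n _))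
... | false | _   = refl

isEven-suc : ∀ t → isEven (suc t) ≡ not (isEven t)
isEven-suc zero          = refl
isEven-suc (suc zero)    = refl
isEven-suc (suc (suc t)) = isEven-suc t

tailCount : ℕ → Entry → ℕ
tailCount t (k , m , b) = if t <ᵇ k then m +ℕ b2n b else 0

tailWeight : ℕ → Entry → ℤ
tailWeight t e = if sptOK t e then sign (tailCount t e) else 0ℤ

partCount : Entry → ℕ
partCount (k , m , b) = m +ℕ b2n b

oexWeight : Entry → ℤ
oexWeight e = if oexOK e then sign (partCount e) else 0ℤ

tailWeight-above : ∀ t j m b → t < j →
                   tailWeight t (j , m , b) ≡ partWeight (isEven j xor isEven t) m b
tailWeight-above t j m b t<j
  rewrite <ᵇ-true t<j | ≢⇒≡ᵇ-false (ℕ.>⇒≢ t<j)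
  with isEven j | isEven t | b
... | true  | _     | true  = refl
... | true  | _     | false = refl
... | false | true  | true  = refl
... | false | true  | false = refl
... | false | false | true  = refl
... | false | false | false = refl

oexWeight-above : ∀ j m b → 1 < j →
                  oexWeight (j , m , b) ≡ partWeight (isEven j xor true) m b
oexWeight-above j m b 1<j rewrite ≢⇒≡ᵇ-false (ℕ.>⇒≢ 1<j) with isEven j
oexWeight-above j zero    true  _ | true  = refl
oexWeight-above j zero    false _ | true  = refl
oexWeight-above j (suc m) b     _ | true  = refl
oexWeight-above j m       b     _ | false = sym (partWeight-opposite m b)

tailWeight-next : ∀ t m b → tailWeight t (suc t , m , b) ≡ partWeight true m b
tailWeight-next t m b =
  trans (tailWeight-above t (suc t) m b ℕ.≤-refl)
        (cong (λ o → partWeight o m b)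
              (trans (cong (_xor isEven t) (isEven-suc t)) (not-xor-self (isEven t))))
  where
  not-xor-self : ∀ x → not x xor x ≡ true
  not-xor-self true  = refl
  not-xor-self false = refl

tailWeight-skip : ∀ t m b → tailWeight t (2 +ℕ t , m , b) ≡ partWeight false m b
tailWeight-skip t m b =
  trans (tailWeight-above t (2 +ℕ t) m b (ℕ.n≤1+n _))
        (cong (λ o → partWeight o m b) (xor-same (isEven t)))

tailWeight-shift : ∀ t j m b → 2 +ℕ t < j →
                   tailWeight t (j , m , b) ≡ tailWeight (2 +ℕ t) (j , m , b)
tailWeight-shift t j m b 2+t<j =
  trans (tailWeight-above t j m b (ℕ.<-trans (ℕ.n<1+n t) (ℕ.<-trans (ℕ.n<1+n (suc t)) 2+t<j)))
        (sym (tailWeight-above (2 +ℕ t) j m b 2+t<j))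

oexWeight-tail : ∀ j m b → 2 < j → oexWeight (j , m , b) ≡ tailWeight 2 (j , m , b)
oexWeight-tail j m b 2<j =
  trans (oexWeight-above j m b (ℕ.<-trans (ℕ.n<1+n 1) 2<j)) (sym (tailWeight-above 2 j m b 2<j))

NormalizedFrom : (Entry → ℤ) → ℕ → Set
NormalizedFrom h s = ∀ {j} → s ≤ j → h (j , 0 , false) ≡ 1ℤ

tailWeight-normalized : ∀ t → NormalizedFrom (tailWeight t) (suc t)
tailWeight-normalized t {j} t<j = tailWeight-above t j 0 false t<j

oexWeight-normalized : NormalizedFrom oexWeight 1
oexWeight-normalized {suc zero}    _ = refl
oexWeight-normalized {suc (suc j)} _ = oexWeight-above (2 +ℕ j) 0 false (s≤s (s≤s z≤n))

smallestNonOver-entriesFrom : ∀ {k} s (v : MultVec k) {x} →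
                              smallestNonOver (entriesFrom s v) ≡ just x → s ≤ x
smallestNonOver-entriesFrom s ((zero  , b) ∷ v) eq   =
  ℕ.<⇒≤ (smallestNonOver-entriesFrom (suc s) v eq)
smallestNonOver-entriesFrom s ((suc m , b) ∷ v) refl = ℕ.≤-refl

spt-skip : ∀ {k} s (v : MultVec k) →
           sptContribution ((s , 0 , false) ∷ entriesFrom (suc s) v) ≡
           sptContribution (entriesFrom (suc s) v)
spt-skip s v with smallestNonOver (entriesFrom (suc s) v) in eq
... | nothing = refl
... | just x  rewrite ≢⇒≡ᵇ-false (ℕ.<⇒≢ (smallestNonOver-entriesFrom (suc s) v eq))
                    | <ᵇ-false (ℕ.<⇒≤ (smallestNonOver-entriesFrom (suc s) v eq)) = refl

spt-overlined-below : ∀ {k} s (v : MultVec k) →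
                      sptContribution ((s , 0 , true) ∷ entriesFrom (suc s) v) ≡ 0ℤ
spt-overlined-below s v with smallestNonOver (entriesFrom (suc s) v) in eq
... | nothing = refl
... | just x  rewrite <ᵇ-false (ℕ.<⇒≤ (smallestNonOver-entriesFrom (suc s) v eq)) = refl

spt-smallest : ∀ s es → sptContribution ((s , 1 , false) ∷ es) ≡ ∏ (tailWeight s) es
spt-smallest s es rewrite ≡ᵇ-refl s | <ᵇ-false (ℕ.≤-refl {s}) =
  allB-sign≡∏ (sptOK s) (tailCount s) es

spt-overlined : ∀ s m es → sptContribution ((s , suc m , true) ∷ es) ≡ 0ℤ
spt-overlined s m es rewrite <ᵇ-false (ℕ.≤-refl {s}) = refl

spt-repeated : ∀ s m es → sptContribution ((s , 2 +ℕ m , false) ∷ es) ≡ 0ℤ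
spt-repeated s m es rewrite ≡ᵇ-refl s = refl

GF-∏-suc : ∀ B s k h n →
           GF B s (suc k) (∏ h) n ≡ mulFactor B s (λ m b → h (s , m , b)) (GF B (suc s) k (∏ h)) n
GF-∏-suc B s k h n =
  trans (GF-suc B s k (∏ h) n) (∑mb-cong B λ m b →
    trans (shift-cong (s *ℕ (m +ℕ b2n b)) n
                      (λ j _ → GF-*ˡ B (suc s) k (h (s , m , b)) (∏ h) j))
          (shift-*ˡ (s *ℕ (m +ℕ b2n b)) (h (s , m , b)) (GF B (suc s) k (∏ h)) n))

GF-∏-cong : ∀ B s k {h h′} n → (∀ {j} m b → s ≤ j → h (j , m , b) ≡ h′ (j , m , b)) →
            GF B s k (∏ h) n ≡ GF B s k (∏ h′) n
GF-∏-cong B s k {h} {h′} n h≡h′ = GF-cong B s k (∏ h) (∏ h′) n (∏-entriesFrom s h≡h′)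
  where
  ∏-entriesFrom : ∀ {k h h′} s → (∀ {j} m b → s ≤ j → h (j , m , b) ≡ h′ (j , m , b)) →
                  (v : MultVec k) → ∏ h (entriesFrom s v) ≡ ∏ h′ (entriesFrom s v)
  ∏-entriesFrom s h≡h′ []            = refl
  ∏-entriesFrom s h≡h′ ((m , b) ∷ v) =
    cong₂ _*_ (h≡h′ m b ℕ.≤-refl)
              (∏-entriesFrom (suc s) (λ m b s<j → h≡h′ m b (ℕ.<⇒≤ s<j)) v)

GF-∏-unit : ∀ B s k h n → (∀ m b → h (s , m , b) ≡ partWeight false m b) →
            GF B s (suc k) (∏ h) n ≡ GF B (suc s) k (∏ h) n
GF-∏-unit B s k h n h≡1 =
  trans (GF-∏-suc B s k h n)
        (trans (mulFactor-cong B s n h≡1 (λ _ _ → refl))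
               (mulFactor-unit B s (GF B (suc s) k (∏ h)) n))

GF-∏-below : ∀ B k s h {n} → NormalizedFrom h s → n < s → GF B s k (∏ h) n ≡ δ n
GF-∏-below B zero    s h {zero}  _    _   = refl
GF-∏-below B zero    s h {suc n} _    _   = refl
GF-∏-below B (suc k) s h {n}     norm n<s = begin
  GF B s (suc k) (∏ h) n
    ≡⟨ GF-∏-suc B s k h n ⟩
  mulFactor B s (λ m b → h (s , m , b)) (GF B (suc s) k (∏ h)) n
    ≡⟨ mulFactor-below B s (λ m b → h (s , m , b)) (GF B (suc s) k (∏ h)) n<s ⟩
  h (s , 0 , false) * GF B (suc s) k (∏ h) n
    ≡⟨ cong₂ _*_ (norm ℕ.≤-refl)
                 (GF-∏-below B k (suc s) h (norm ∘ ℕ.<⇒≤) (ℕ.m<n⇒m<1+n n<s)) ⟩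
  1ℤ * δ n
    ≡⟨ ℤ.*-identityˡ (δ n) ⟩
  δ n ∎

GF-∏-extend : ∀ B k s h {n} → NormalizedFrom h s → n < s +ℕ k →
              GF B s k (∏ h) n ≡ GF B s (suc k) (∏ h) n
GF-∏-extend B zero s h {n} norm n<s+0 =
  trans (GF-∏-below B 0 s h norm n<s) (sym (GF-∏-below B 1 s h norm n<s))
  where
  n<s : n < s
  n<s = subst (n <_) (ℕ.+-identityʳ s) n<s+0
GF-∏-extend B (suc k) s h {n} norm n<s+1+k = begin
  GF B s (suc k) (∏ h) n
    ≡⟨ GF-∏-suc B s k h n ⟩
  mulFactor B s (λ m b → h (s , m , b)) (GF B (suc s) k (∏ h)) n
    ≡⟨ mulFactor-cong B s {g = λ m b → h (s , m , b)} n (λ _ _ → refl) (λ j j≤n →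
         GF-∏-extend B k (suc s) h {j} (norm ∘ ℕ.<⇒≤) (ℕ.≤-<-trans j≤n n<1+s+k)) ⟩
  mulFactor B s (λ m b → h (s , m , b)) (GF B (suc s) (suc k) (∏ h)) n
    ≡⟨ GF-∏-suc B s (suc k) h n ⟨
  GF B s (2 +ℕ k) (∏ h) n ∎
  where
  n<1+s+k : n < suc s +ℕ k
  n<1+s+k = subst (n <_) (ℕ.+-suc s k) n<s+1+k

-- The series P_t and ∑_t q^t P_t

-- tailGF B t = P_t and sptGF B s = ∑_{t ≥ s} q^t P_t, both truncated as in GF
tailGF : (B t k : ℕ) → Series
tailGF B t k = GF B (suc t) k (∏ (tailWeight t))

sptGF : (B s k : ℕ) → Series
sptGF B s k = GF B s k sptContribution

tailGF-unfold : ∀ B t k n →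
                tailGF B t (2 +ℕ k) n ≡
                mulFactor B (suc t) (partWeight true) (tailGF B (2 +ℕ t) k) n
tailGF-unfold B t k n =
  trans (GF-∏-suc B (suc t) (suc k) (tailWeight t) n)
        (mulFactor-cong B (suc t) n (tailWeight-next t) (λ j _ → drop-same-parity j))
  where
  drop-same-parity : ∀ j →
                     GF B (2 +ℕ t) (suc k) (∏ (tailWeight t)) j ≡ tailGF B (2 +ℕ t) k j
  drop-same-parity j =
    trans (GF-∏-unit B (2 +ℕ t) k (tailWeight t) j (tailWeight-skip t))
          (GF-∏-cong B (3 +ℕ t) k j (λ m b 3+t≤j → tailWeight-shift t _ m b 3+t≤j))

tailGF-recurrence : ∀ B t k {n} → n ≤ B →
                    tailGF B t (2 +ℕ k) n + shift (suc t) (tailGF B t (2 +ℕ k)) n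
                    ≡ tailGF B (2 +ℕ t) k n - shift (suc t) (tailGF B (2 +ℕ t) k) n
tailGF-recurrence B t k {n} n≤B =
  trans (cong₂ _+_ (tailGF-unfold B t k n)
                   (shift-cong (suc t) n (λ j _ → tailGF-unfold B t k j)))
        (mulFactor-sign B t (tailGF B (2 +ℕ t) k) n≤B)

tailGF-extend : ∀ B t k {n} → n < suc t +ℕ k → tailGF B t k n ≡ tailGF B t (suc k) n
tailGF-extend B t k = GF-∏-extend B k (suc t) (tailWeight t) (tailWeight-normalized t)

sptGF-empty : ∀ B s n → sptGF B s 0 n ≡ 0ℤ
sptGF-empty B s zero    = refl
sptGF-empty B s (suc n) = refl

sptGF-unfold : ∀ B s k n →
               sptGF (suc B) s (suc k) n ≡
               sptGF (suc B) (suc s) k n + shift s (tailGF (suc B) s k) n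
sptGF-unfold B s k n = begin
  sptGF (suc B) s (suc k) n
    ≡⟨ GF-suc (suc B) s k sptContribution n ⟩
  ∑mb (suc B) term
    ≡⟨ ∑mb-truncate term {1} {suc B} (s≤s z≤n) beyond ⟩
  (term 0 true + (term 0 false + 0ℤ)) + ((term 1 true + (term 1 false + 0ℤ)) + 0ℤ)
    ≡⟨ collect term₀₁ term₀₀ term₁₁ term₁₀ ⟩
  sptGF (suc B) (suc s) k n + shift s (tailGF (suc B) s k) n ∎
  where
  withHead : ℕ → Bool → List Entry → ℤ
  withHead m b = sptContribution ∘ ((s , m , b) ∷_)

  rest : ℕ → Bool → Series
  rest m b = GF (suc B) (suc s) k (withHead m b)

  term : ℕ → Bool → ℤ
  term m b = shift (s *ℕ (m +ℕ b2n b)) (rest m b) n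

  beyond : ∀ m b → 1 < m → term m b ≡ 0ℤ
  beyond (suc zero)    _     (s≤s ())
  beyond (suc (suc m)) true  _ = shift-zero (s *ℕ (2 +ℕ m +ℕ 1)) n λ j →
    GF-zero (suc B) (suc s) k (withHead (2 +ℕ m) true) j
            (λ v → spt-overlined s (suc m) (entriesFrom (suc s) v))
  beyond (suc (suc m)) false _ = shift-zero (s *ℕ (2 +ℕ m +ℕ 0)) n λ j →
    GF-zero (suc B) (suc s) k (withHead (2 +ℕ m) false) j
            (λ v → spt-repeated s m (entriesFrom (suc s) v))

  term₀₁ : term 0 true ≡ 0ℤ
  term₀₁ = shift-zero (s *ℕ 1) n λ j →
    GF-zero (suc B) (suc s) k (withHead 0 true) j (spt-overlined-below s)

  term₀₀ : term 0 false ≡ sptGF (suc B) (suc s) k n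
  term₀₀ = trans (cong (λ d → shift d (rest 0 false) n) (ℕ.*-zeroʳ s))
                 (GF-cong (suc B) (suc s) k (withHead 0 false) sptContribution n (spt-skip s))

  term₁₁ : term 1 true ≡ 0ℤ
  term₁₁ = shift-zero (s *ℕ 2) n λ j →
    GF-zero (suc B) (suc s) k (withHead 1 true) j
            (λ v → spt-overlined s 0 (entriesFrom (suc s) v))

  term₁₀ : term 1 false ≡ shift s (tailGF (suc B) s k) n
  term₁₀ = trans (cong (λ d → shift d (rest 1 false) n) (ℕ.*-identityʳ s))
                 (shift-cong s n λ j _ →
                   GF-cong (suc B) (suc s) k (withHead 1 false) (∏ (tailWeight s)) j
                           (λ v → spt-smallest s (entriesFrom (suc s) v)))

  collect : ∀ {a b c d x y} → a ≡ 0ℤ → b ≡ x → c ≡ 0ℤ → d ≡ y →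
            (a + (b + 0ℤ)) + ((c + (d + 0ℤ)) + 0ℤ) ≡ x + y
  collect {x = x} {y} refl refl refl refl = drop-zeros x y
    where
    drop-zeros : ∀ x y → (0ℤ + (x + 0ℤ)) + ((0ℤ + (y + 0ℤ)) + 0ℤ) ≡ x + y
    drop-zeros = solve-∀

sptGF-extend : ∀ B s k {n} → n < s +ℕ k → sptGF (suc B) s k n ≡ sptGF (suc B) s (suc k) n
sptGF-extend B s zero {n} n<s+0 =
  trans (sptGF-empty (suc B) s n)
        (sym (trans (sptGF-unfold B s 0 n)
                    (cong₂ _+_ (sptGF-empty (suc B) (suc s) n) (shift-beyond s _ n<s))))
  where
  n<s : n < s
  n<s = subst (n <_) (ℕ.+-identityʳ s) n<s+0
sptGF-extend B s (suc k) {n} n<s+1+k = begin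
  sptGF (suc B) s (suc k) n
    ≡⟨ sptGF-unfold B s k n ⟩
  sptGF (suc B) (suc s) k n + shift s (tailGF (suc B) s k) n
    ≡⟨ cong₂ _+_ (sptGF-extend B (suc s) k n<1+s+k)
                 (shift-cong s n λ j j≤n →
                   tailGF-extend (suc B) s k (ℕ.≤-<-trans j≤n n<1+s+k)) ⟩
  sptGF (suc B) (suc s) (suc k) n + shift s (tailGF (suc B) s (suc k)) n
    ≡⟨ sptGF-unfold B s (suc k) n ⟨
  sptGF (suc B) s (2 +ℕ k) n ∎
  where
  n<1+s+k : n < suc s +ℕ k
  n<1+s+k = subst (n <_) (ℕ.+-suc s k) n<s+1+k

-- the series identity sptGF_(t+2) + q² sptGF_t = 2q - q (P_t + P_(t+1)), read off at q^(n+2)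
sptGF-telescope : ∀ B t k {n} → 2 +ℕ n ≤ suc B → n < t +ℕ k →
                  sptGF (suc B) (2 +ℕ t) k (2 +ℕ n) + sptGF (suc B) t (2 +ℕ k) n
                  ≡ - (tailGF (suc B) (suc t) k (suc n) + tailGF (suc B) t (suc k) (suc n))
sptGF-telescope B t zero {n} _ n<t+0 =
  trans (cong₂ _+_ (sptGF-empty (suc B) (2 +ℕ t) (2 +ℕ n)) sptGF-t-2≡0)
        (sym (cong (λ x → - (0ℤ + x))
                   (GF-∏-below (suc B) 1 (suc t) (tailWeight t) (tailWeight-normalized t)
                               (s≤s n<t))))
  where
  n<t : n < t
  n<t = subst (n <_) (ℕ.+-identityʳ t) n<t+0
  sptGF-t-2≡0 : sptGF (suc B) t 2 n ≡ 0ℤ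
  sptGF-t-2≡0 =
    trans (sym (trans (sptGF-extend B t 0 n<t+0)
                      (sptGF-extend B t 1 (ℕ.<-≤-trans n<t (ℕ.m≤m+n t 1)))))
          (sptGF-empty (suc B) t n)
sptGF-telescope B t (suc k) {n} 2+n≤1+B n<t+1+k = begin
  sptGF (suc B) (2 +ℕ t) (suc k) (2 +ℕ n) + sptGF (suc B) t (3 +ℕ k) n
    ≡⟨ cong₂ _+_ (sptGF-unfold B (2 +ℕ t) k (2 +ℕ n)) (sptGF-unfold B t (2 +ℕ k) n) ⟩
  (sptGF (suc B) (3 +ℕ t) k (2 +ℕ n) + shift t (tailGF (suc B) (2 +ℕ t) k) n)
    + (sptGF (suc B) (suc t) (2 +ℕ k) n + shift t (tailGF (suc B) t (2 +ℕ k)) n)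
    ≡⟨ step (sptGF (suc B) (3 +ℕ t) k (2 +ℕ n)) (sptGF (suc B) (suc t) (2 +ℕ k) n)
            (shift t (tailGF (suc B) (2 +ℕ t) k) n) (shift t (tailGF (suc B) t (2 +ℕ k)) n)
            (tailGF (suc B) t (2 +ℕ k) (suc n)) (tailGF (suc B) (suc t) (suc k) (suc n))
            (tailGF (suc B) (2 +ℕ t) k (suc n))
            (sptGF-telescope B (suc t) k 2+n≤1+B (subst (n <_) (ℕ.+-suc t k) n<t+1+k))
            (tailGF-recurrence (suc B) t k (ℕ.<⇒≤ 2+n≤1+B)) ⟩
  - (tailGF (suc B) (suc t) (suc k) (suc n) + tailGF (suc B) t (2 +ℕ k) (suc n)) ∎
  where
  step : ∀ a b x y P₀ P₁ P₂ → a + b ≡ - (P₂ + P₁) → P₀ + y ≡ P₂ - x →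
         (a + x) + (b + y) ≡ - (P₁ + P₀)
  step a b x y P₀ P₁ P₂ ab py = begin
    (a + x) + (b + y)                   ≡⟨ regroup a b x y P₀ ⟩
    ((a + b) + (P₀ + y)) + (x - P₀)     ≡⟨ cong₂ (λ u v → (u + v) + (x - P₀)) ab py ⟩
    (- (P₂ + P₁) + (P₂ - x)) + (x - P₀) ≡⟨ cancel P₀ P₁ P₂ x ⟩
    - (P₁ + P₀)                         ∎
    where
    regroup : ∀ a b x y P₀ → (a + x) + (b + y) ≡ ((a + b) + (P₀ + y)) + (x - P₀)
    regroup = solve-∀
    cancel : ∀ P₀ P₁ P₂ x → (- (P₂ + P₁) + (P₂ - x)) + (x - P₀) ≡ - (P₁ + P₀)
    cancel = solve-∀

sptGF₁-identity : ∀ B k {M} → 2 +ℕ M ≤ suc B → M < k →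
                  sptGF (suc B) 1 (suc k) (2 +ℕ M) + sptGF (suc B) 1 (suc k) M
                  ≡ - (tailGF (suc B) 0 (suc k) (suc M) + tailGF (suc B) 0 (suc k) M)
sptGF₁-identity B k {M} 2+M≤1+B M<k = begin
  sptGF (suc B) 1 (suc k) (2 +ℕ M) + sptGF (suc B) 1 (suc k) M
    ≡⟨ cong (_+ sptGF (suc B) 1 (suc k) M) (sptGF-unfold B 1 k (2 +ℕ M)) ⟩
  (sptGF (suc B) 2 k (2 +ℕ M) + tailGF (suc B) 1 k (suc M)) + sptGF (suc B) 1 (suc k) M
    ≡⟨ rearrange (sptGF (suc B) 2 k (2 +ℕ M)) (sptGF (suc B) 1 (suc k) M) (tailGF (suc B) 1 k (suc M))
                 (tailGF (suc B) 0 (suc k) M) (tailGF (suc B) 0 (suc k) (suc M))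
                 (trans (cong (sptGF (suc B) 2 k (2 +ℕ M) +_) (sym (sptGF-unfold B 0 (suc k) M)))
                        (sptGF-telescope B 0 k 2+M≤1+B M<k)) ⟩
  - (tailGF (suc B) 0 (suc k) (suc M) + tailGF (suc B) 0 (suc k) M) ∎
  where
  rearrange : ∀ u v p₁ p₀ p₀′ → u + (v + p₀) ≡ - (p₁ + p₀′) →
              (u + p₁) + v ≡ - (p₀′ + p₀)
  rearrange u v p₁ p₀ p₀′ eq = begin
    (u + p₁) + v           ≡⟨ regroup u v p₁ p₀ ⟩
    (u + (v + p₀)) + (p₁ - p₀) ≡⟨ cong (_+ (p₁ - p₀)) eq ⟩
    - (p₁ + p₀′) + (p₁ - p₀) ≡⟨ cancel p₁ p₀ p₀′ ⟩
    - (p₀′ + p₀)           ∎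
    where
    regroup : ∀ u v p₁ p₀ → (u + p₁) + v ≡ (u + (v + p₀)) + (p₁ - p₀)
    regroup = solve-∀
    cancel : ∀ p₁ p₀ p₀′ → - (p₁ + p₀′) + (p₁ - p₀) ≡ - (p₀′ + p₀)
    cancel = solve-∀

spt1o'-as-sptGF : ∀ M → spt1o' M ≡ sptGF (2 +ℕ M) 1 (2 +ℕ M) M
spt1o'-as-sptGF M = begin
  spt1o' M                     ≡⟨ GF-bound M 0 sptContribution M ℕ.≤-refl (ℕ.m≤n+m M 2) ⟩
  sptGF (2 +ℕ M) 1 M M         ≡⟨ sptGF-extend (suc M) 1 M (ℕ.n<1+n M) ⟩
  sptGF (2 +ℕ M) 1 (suc M) M   ≡⟨ sptGF-extend (suc M) 1 (suc M) (ℕ.m<n⇒m<1+n (ℕ.n<1+n M)) ⟩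
  sptGF (2 +ℕ M) 1 (2 +ℕ M) M  ∎

poex'-as-GF : ∀ n → poex' n ≡ GF n 1 n (∏ oexWeight) n
poex'-as-GF n = ∑-cong (λ v → as-coeff (entries v)) (candidates n n)
  where
  as-coeff : ∀ es →
             (if (weight es ≡ᵇ n) ∧ allB oexOK es then sign (numParts es) else 0ℤ) ≡
             coeff n (∏ oexWeight) es
  as-coeff es with weight es ≡ᵇ n
  ... | true  = allB-sign≡∏ oexOK partCount es
  ... | false = refl

poex'-as-tailGF : ∀ M → poex' (suc M) ≡ tailGF (2 +ℕ M) 2 M (suc M) - tailGF (2 +ℕ M) 2 M M
poex'-as-tailGF M = begin
  poex' (suc M)
    ≡⟨ poex'-as-GF (suc M) ⟩
  GF (suc M) 1 (suc M) (∏ oexWeight) (suc M)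
    ≡⟨ GF-bound (suc M) 0 (∏ oexWeight) (suc M) ℕ.≤-refl (ℕ.n≤1+n (suc M)) ⟩
  GF B 1 (suc M) (∏ oexWeight) (suc M)
    ≡⟨ GF-∏-extend B (suc M) 1 oexWeight oexWeight-normalized ℕ.≤-refl ⟩
  GF B 1 (2 +ℕ M) (∏ oexWeight) (suc M)
    ≡⟨ GF-∏-suc B 1 (suc M) oexWeight (suc M) ⟩
  mulFactor B 1 (λ m b → oexWeight (1 , m , b)) X (suc M)
    ≡⟨ mulFactor-binomial B 1 (λ m b → oexWeight (1 , m , b)) X (suc M) (λ m b → refl) ⟩
  - 1ℤ * X M + 1ℤ * X (suc M)
    ≡⟨ one-minus-q (X M) (X (suc M)) ⟩
  X (suc M) - X M
    ≡⟨ cong₂ _-_ (drop-part-2 (suc M)) (drop-part-2 M) ⟩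
  tailGF B 2 M (suc M) - tailGF B 2 M M ∎
  where
  B = 2 +ℕ M

  X : Series
  X = GF B 2 (suc M) (∏ oexWeight)

  one-minus-q : ∀ x y → - 1ℤ * x + 1ℤ * y ≡ y - x
  one-minus-q = solve-∀

  drop-part-2 : ∀ j → X j ≡ tailGF B 2 M j
  drop-part-2 j =
    trans (GF-∏-unit B 2 M oexWeight j (λ m b → oexWeight-above 2 m b (s≤s (s≤s z≤n))))
          (GF-∏-cong B 3 M j (λ m b 2<j → oexWeight-tail _ m b 2<j))

corollary4p3 : (n : ℕ) → 2 < n →
    spt1o' n + spt1o' (n ∸ 2) ≡ - poex' (n ∸ 1)
-- the argument covers n = 2 as well
corollary4p3 zero          ()
corollary4p3 (suc zero)    (s≤s ())
corollary4p3 (suc (suc M)) _ = begin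
  spt1o' (2 +ℕ M) + spt1o' M
    ≡⟨ cong (spt1o' (2 +ℕ M) +_) (spt1o'-as-sptGF M) ⟩
  sptGF B 1 B (2 +ℕ M) + sptGF B 1 B M
    ≡⟨ sptGF₁-identity (suc M) (suc M) ℕ.≤-refl (ℕ.n<1+n M) ⟩
  - (tailGF B 0 B (suc M) + tailGF B 0 B M)
    ≡⟨ cong -_ (tailGF-recurrence B 0 M (ℕ.n≤1+n (suc M))) ⟩
  - (tailGF B 2 M (suc M) - tailGF B 2 M M)
    ≡⟨ cong -_ (poex'-as-tailGF M) ⟨
  - poex' (suc M) ∎
  where
  B = 2 +ℕ M
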